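{- Let $k\geq 3$ be an integer and let $G$ be a 2-connected planar 3-regular graph. Let $F$ be the graph obtained from $G$ by replacing each edge $e=uv\in E(G)$ by the gadget $G_e$ described below. Then \[\gamma_{[kR]}(F)=i_{[kR]}(F)=\tau(G)+k|V(G)|+(3k+2)|E(G)|.\]
   Context: All graphs are finite and simple. The gadget $G_e$ for an edge $e=uv$ (with an arbitrary choice of which endpoint is $u$) consists of ten new vertices $x_1^e,\ldots,x_{10}^e$ and the edges $ux_1^e, x_1^ex_2^e, x_2^ex_3^e, x_3^ex_4^e, x_4^ex_5^e, x_5^ev$, $x_6^ex_7^e, x_7^ex_8^e, x_8^ex_9^e, x_9^ex_{10}^e$, $x_2^ex_7^e$ and $x_4^ex_9^e$; replacing $e$ by $G_e$ means deleting the edge $uv$ and adding these vertices and edges (so $V(F)=V(G)\cup\bigcup_e\{x_1^e,\ldots,x_{10}^e\}$). $\tau(G)$ denotes the minimum size of a vertex cover of $G$ (a set of vertices meeting every edge). For $f\colon V(F)\to\mathbb{Z}_{\ge 0}$ and $S\subseteq V(F)$, $f(S)=\sum_{v\in S}f(v)$, and $AN(v)=\{w\in N(v): f(w)\ge 1\}$. A $[k]$-Roman dominating function ($[k]$-RDF) of a graph $H$ is a function $f\colon V(H)\to\{0,1,\ldots,k+1\}$ such that $f(N[v])\ge k+|AN(v)|$ for every vertex $v$ with $f(v)<k$; its weight is $f(V(H))$. $\gamma_{[kR]}(H)$ is the minimum weight of a $[k]$-RDF of $H$. An independent $[k]$-RDF is a $[k]$-RDF whose set of vertices with positive labels is independent,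 and $i_{[kR]}(H)$ is the minimum weight of an independent $[k]$-RDF of $H$. -}

module Defs where

open import Data.Nat using (ℕ; zero; suc; _+_; _*_; _≤_; _<_; _≤ᵇ_)
open import Data.Nat.Properties using ()
open import Data.Bool using (Bool; true; false; _∧_; _∨_; not; if_then_else_)
open import Data.Fin using (Fin; toℕ)
import Data.Fin as Fin
open import Data.List using (List; []; _∷_; map; length; allFin; concatMap; _++_; upTo)
open import Data.Nat.ListAction using (sum)
open import Data.Product using (Σ; ∃; _×_; _,_; proj₁; proj₂)
open import Data.Sum using (_⊎_; inj₁; inj₂)
open import Data.Unit using (⊤)
open import Relation.Nullary using (¬_)
open import Relation.Nullary.Decidable using (⌊_⌋)
open import Relation.Binary.PropositionalEquality using (_≡_; _≢_)
open import Function using (_∘_)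

filterᵇ : {A : Set} → (A → Bool) → List A → List A
filterᵇ p [] = []
filterᵇ p (x ∷ xs) = if p x then x ∷ filterᵇ p xs else filterᵇ p xs

allᵇ : {A : Set} → (A → Bool) → List A → Bool
allᵇ p [] = true
allᵇ p (x ∷ xs) = p x ∧ allᵇ p xs

-- Generic finite graphs given by an enumeration of the vertex set
-- (each vertex exactly once) and a Boolean adjacency relation.

record FinGraph : Set₁ where
  field
    V   : Set
    vs  : List V
    adj : V → V → Bool        -- adjacency (symmetric, irreflexive)
open FinGraph public

module _ (H : FinGraph) where
  weight : (V H → ℕ) → ℕ
  weight f = sum (map f (vs H))

  -- f(N(v)) (open neighbourhood; f(N[v]) = f v + sumN f v)
  sumN : (V H → ℕ) → V H → ℕ
  sumN f v = sum (map f (filterᵇ (λ w → adj H v w) (vs H)))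

  cardAN : (V H → ℕ) → V H → ℕ
  cardAN f v = length (filterᵇ (λ w → adj H v w ∧ (1 ≤ᵇ f w)) (vs H))

  IsKRDF : ℕ → (V H → ℕ) → Set
  IsKRDF k f =
    (∀ v → f v ≤ suc k) ×
    (∀ v → f v < k → k + cardAN f v ≤ f v + sumN f v)

  PositiveIndependent : (V H → ℕ) → Set
  PositiveIndependent f =
    ∀ u w → adj H u w ≡ true → f u ≡ 0 ⊎ f w ≡ 0

  IsIndKRDF : ℕ → (V H → ℕ) → Set
  IsIndKRDF k f = IsKRDF k f × PositiveIndependent f

  KRDFWeight : ℕ → ℕ → Set
  KRDFWeight k w = Σ (V H → ℕ) λ f → IsKRDF k f × weight f ≡ w

  IndKRDFWeight : ℕ → ℕ → Set
  IndKRDFWeight k w = Σ (V H → ℕ) λ f → IsIndKRDF k f × weight f ≡ w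

IsMinimum : (ℕ → Set) → ℕ → Set
IsMinimum P w = P w × (∀ w' → P w' → w ≤ w')

GammaKR≡ : FinGraph → ℕ → ℕ → Set
GammaKR≡ H k w = IsMinimum (KRDFWeight H k) w

IKR≡ : FinGraph → ℕ → ℕ → Set
IKR≡ H k w = IsMinimum (IndKRDFWeight H k) w

-- The graph G: vertex set Fin n, edge set Fin m, each edge e given with
-- an (arbitrary) orientation  ends e = (u , v).

record EGraph : Set where
  field
    n    : ℕ
    m    : ℕ
    ends : Fin m → Fin n × Fin n
open EGraph public

IsSimple : EGraph → Set
IsSimple G =
  (∀ e → proj₁ (ends G e) ≢ proj₂ (ends G e)) ×
  (∀ e e' → e ≢ e' →
     (ends G e ≢ ends G e') ×
     (ends G e ≢ (proj₂ (ends G e') , proj₁ (ends G e'))))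

incident : (G : EGraph) → Fin (m G) → Fin (n G) → Bool
incident G e x = ⌊ proj₁ (ends G e) Fin.≟ x ⌋ ∨ ⌊ proj₂ (ends G e) Fin.≟ x ⌋

degree : (G : EGraph) → Fin (n G) → ℕ
degree G x = length (filterᵇ (λ e → incident G e x) (allFin (m G)))

Cubic : EGraph → Set
Cubic G = ∀ x → degree G x ≡ 3

AdjG : (G : EGraph) → Fin (n G) → Fin (n G) → Set
AdjG G x y = ∃ λ e → ends G e ≡ (x , y) ⊎ ends G e ≡ (y , x)

data Walk (G : EGraph) (ok : Fin (n G) → Set) : Fin (n G) → Fin (n G) → Set where
  here : ∀ {x} → Walk G ok x x
  step : ∀ {x y z} → AdjG G x y → ok y → Walk G ok y z → Walk G ok x z

Connected : EGraph → Set
Connected G = ∀ x y → Walk G (λ _ → ⊤) x y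

TwoConnected : EGraph → Set
TwoConnected G =
  (3 ≤ n G) × Connected G ×
  (∀ c x y → x ≢ c → y ≢ c → Walk G (λ w → w ≢ c) x y)

IsVertexCover : (G : EGraph) → (Fin (n G) → Bool) → Set
IsVertexCover G S =
  ∀ e → S (proj₁ (ends G e)) ≡ true ⊎ S (proj₂ (ends G e)) ≡ true

coverSize : (G : EGraph) → (Fin (n G) → Bool) → ℕ
coverSize G S = length (filterᵇ S (allFin (n G)))

VCSize : EGraph → ℕ → Set
VCSize G t = Σ (Fin (n G) → Bool) λ S → IsVertexCover G S × coverSize G S ≡ t

Tau≡ : EGraph → ℕ → Set
Tau≡ G t = IsMinimum (VCSize G) t

-- Planarity via rotation systems (combinatorial embeddings): a connected
-- graph is planar iff it has a rotation system whose faces satisfy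
-- Euler's formula  |V| - |E| + #faces = 2.

Dart : EGraph → Set
Dart G = Fin (m G) × Bool

tail : (G : EGraph) → Dart G → Fin (n G)
tail G (e , false) = proj₁ (ends G e)
tail G (e , true)  = proj₂ (ends G e)

rev : (G : EGraph) → Dart G → Dart G
rev G (e , b) = (e , not b)

allDarts : (G : EGraph) → List (Dart G)
allDarts G = concatMap (λ e → (e , false) ∷ (e , true) ∷ []) (allFin (m G))

dartIndex : (G : EGraph) → Dart G → ℕ
dartIndex G (e , false) = 2 * toℕ e
dartIndex G (e , true)  = suc (2 * toℕ e)

iter : {A : Set} → (A → A) → ℕ → A → A
iter f zero    a = a
iter f (suc j) a = f (iter f j a)

record RotationSystem (G : EGraph) : Set where
  field
    ρ      : Dart G → Dart G
    ρ⁻¹    : Dart G → Dart G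
    inv₁   : ∀ d → ρ (ρ⁻¹ d) ≡ d
    inv₂   : ∀ d → ρ⁻¹ (ρ d) ≡ d
    local  : ∀ d → tail G (ρ d) ≡ tail G d
    cyclic : ∀ d d' → tail G d ≡ tail G d' → ∃ λ j → iter ρ j d ≡ d'
open RotationSystem public

φ : {G : EGraph} → RotationSystem G → Dart G → Dart G
φ {G} R d = ρ R (rev G d)

-- d is the dart of least index in its φ-orbit (orbits have size ≤ 2m)
isOrbitRep : {G : EGraph} → RotationSystem G → Dart G → Bool
isOrbitRep {G} R d =
  allᵇ (λ j → dartIndex G d ≤ᵇ dartIndex G (iter (φ R) j d))
                (upTo (2 * m G))

numFaces : {G : EGraph} → RotationSystem G → ℕ
numFaces {G} R = length (filterᵇ (isOrbitRep R) (allDarts G))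

Planar : EGraph → Set
Planar G = Σ (RotationSystem G) λ R → n G + numFaces R ≡ m G + 2

-- The graph F obtained by replacing each edge e = uv by the gadget G_e.
-- Vertex inj₂ (e , j) is x_{j+1}^e.

VF : EGraph → Set
VF G = Fin (n G) ⊎ (Fin (m G) × Fin 10)

-- internal gadget edges, 0-based indices
internal : ℕ → ℕ → Bool
internal 0 1 = true
internal 1 2 = true
internal 2 3 = true
internal 3 4 = true
internal 5 6 = true
internal 6 7 = true
internal 7 8 = true
internal 8 9 = true
internal 1 6 = true
internal 3 8 = true
internal _ _ = false

arcF : (G : EGraph) → VF G → VF G → Bool
arcF G (inj₁ w) (inj₂ (e , j)) = ⌊ w Fin.≟ proj₁ (ends G e) ⌋ ∧ ⌊ toℕ j Data.Nat.≟ 0 ⌋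
arcF G (inj₂ (e , j)) (inj₁ w) = ⌊ w Fin.≟ proj₂ (ends G e) ⌋ ∧ ⌊ toℕ j Data.Nat.≟ 4 ⌋
arcF G (inj₂ (e , a)) (inj₂ (e' , b)) = ⌊ e Fin.≟ e' ⌋ ∧ internal (toℕ a) (toℕ b)
arcF G (inj₁ _) (inj₁ _) = false

F : EGraph → FinGraph
F G = record
  { V   = VF G
  ; vs  = map inj₁ (allFin (n G)) ++
          concatMap (λ e → map (λ j → inj₂ (e , j)) (allFin 10)) (allFin (m G))
  ; adj = λ x y → arcF G x y ∨ arcF G y x
  }

-- Every [k]-RDF f of F has f(N[w]) ≥ k at each vertex w of G, and the weight of f splits into
-- these closed-neighbourhood weights plus, for each edge e, the weight of G_e without its ports
-- x₁, x₅ (which lie in N(u), N(v)).  In G_e the closed neighbourhoods of x₃, x₆, x₁₀ together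
-- with x₈ partition this remainder, forcing it to weigh at least 3k+2, and at least 3k+3 when both
-- ends of e are light (f(N[·]) = k).  The heavy vertices plus one end of each edge with two light
-- ends form a vertex cover, so f weighs at least τ(G) + k|V| + (3k+2)|E|.  Conversely, label a
-- minimum vertex cover S by k+1, the other vertices by k and every gadget by a fixed independent
-- pattern of weight 3k+2 in which each 0-labelled vertex has a neighbour labelled k+1.

module Submission where

open import Data.Bool using (Bool; true; false; _∧_; _∨_; not; if_then_else_)
import Data.Bool as Bool
open import Data.Bool.Properties using (∧-zeroʳ; ∧-identityʳ; ∨-identityʳ; ∨-zeroʳ; ∨-comm)
open import Data.Fin using (Fin; toℕ)
import Data.Fin as Fin
open import Data.Fin.Patterns
open import Data.Fin.Properties using (punchInᵢ≢i; all?; any?)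
open import Data.List using (List; []; _∷_; map; length; allFin; concatMap; _++_; tabulate)
open import Data.List.Properties using (map-++; map-tabulate; map-∘)
open import Data.List.Membership.Propositional using (_∈_)
open import Data.List.Membership.Propositional.Properties
  using (∈-++⁺ˡ; ∈-++⁺ʳ; ∈-map⁺; ∈-allFin; ∈-concat⁺′)
open import Data.List.Relation.Unary.Any using (here; there)
open import Data.Nat using (ℕ; zero; suc; _+_; _*_; _≤_; _<_; _≤ᵇ_; z≤n; s≤s; _<?_)
import Data.Nat as ℕ
open import Data.Nat.ListAction using (sum)
open import Data.Nat.ListAction.Properties using (sum-++)
open import Data.Nat.Properties
open import Algebra.Properties.CommutativeMonoid.Sum +-0-commutativeMonoid
  using (sum-syntax; sum-cong-≗; sum-replicate-zero; sum-remove; ∑-distrib-+; ∑-comm)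
open import Algebra.Properties.CommutativeSemigroup +-commutativeSemigroup using (x∙yz≈y∙xz)
open import Data.Nat.Tactic.RingSolver using (solve-∀)
open import Data.Product using (_×_; _,_; proj₁; proj₂; ∃-syntax)
open import Data.Sum using (_⊎_; inj₁; inj₂)
import Data.Sum as Sum
open import Function using (_∘_)
open import Relation.Binary.Definitions using (DecidableEquality)
open import Relation.Binary.PropositionalEquality
open import Relation.Nullary using (Dec; ¬_; yes; no; contradiction)
open import Relation.Nullary.Decidable
  using (⌊_⌋; dec-true; dec-false; isYes≗does; from-yes; _→-dec_; _⊎-dec_; _×-dec_)

open import Defs

isYes-true : ∀ {A : Set} (a? : Dec A) → A → ⌊ a? ⌋ ≡ true
isYes-true a? a = trans (isYes≗does a?) (dec-true a? a)

isYes-false : ∀ {A : Set} (a? : Dec A) → ¬ A → ⌊ a? ⌋ ≡ false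
isYes-false a? ¬a = trans (isYes≗does a?) (dec-false a? ¬a)

𝟙 : Bool → ℕ
𝟙 b = if b then 1 else 0

signum : ℕ → ℕ
signum y = 𝟙 (1 ≤ᵇ y)

signum≤id : ∀ y → signum y ≤ y
signum≤id zero    = z≤n
signum≤id (suc y) = s≤s z≤n

∑-mono-≤ : ∀ {n} {g h : Fin n → ℕ} → (∀ i → g i ≤ h i) → ∑[ i < n ] g i ≤ ∑[ i < n ] h i
∑-mono-≤ {zero}  g≤h = z≤n
∑-mono-≤ {suc n} g≤h = +-mono-≤ (g≤h Fin.zero) (∑-mono-≤ (g≤h ∘ Fin.suc))

∑-const : ∀ n c → ∑[ _ < n ] c ≡ n * c
∑-const zero    c = refl
∑-const (suc n) c = cong (c +_) (∑-const n c)

∑-const-+ : ∀ n c (h : Fin n → ℕ) → ∑[ i < n ] (c + h i) ≡ n * c + ∑[ i < n ] h i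
∑-const-+ n c h = trans (∑-distrib-+ (λ _ → c) h) (cong (_+ ∑[ i < n ] h i) (∑-const n c))

∑-term-≤ : ∀ {n} (h : Fin n → ℕ) i → h i ≤ ∑[ j < n ] h j
∑-term-≤ {suc n} h i = ≤-trans (m≤m+n _ _) (≤-reflexive (sym (sum-remove {i = i} h)))

∑-supported : ∀ {n} (h : Fin n → ℕ) u → (∀ x → x ≢ u → h x ≡ 0) → ∑[ x < n ] h x ≡ h u
∑-supported {suc n} h u h-zero = begin
  ∑[ x < suc n ] h x                   ≡⟨ sum-remove {i = u} h ⟩
  h u + ∑[ x < n ] h (Fin.punchIn u x) ≡⟨ cong (h u +_) (sum-cong-≗ (λ x → h-zero _ (punchInᵢ≢i u x))) ⟩
  h u + ∑[ x < n ] 0                   ≡⟨ cong (h u +_) (sum-replicate-zero n) ⟩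
  h u + 0                              ≡⟨ +-identityʳ (h u) ⟩
  h u                                  ∎
  where open ≡-Reasoning

∑-δ : ∀ {n} (u : Fin n) (c : Fin n → ℕ) → ∑[ x < n ] (if ⌊ x Fin.≟ u ⌋ then c x else 0) ≡ c u
∑-δ u c = trans (∑-supported _ u off-u) (cong (if_then c u else 0) (isYes-true (u Fin.≟ u) refl))
  where
  off-u : ∀ x → x ≢ u → (if ⌊ x Fin.≟ u ⌋ then c x else 0) ≡ 0
  off-u x x≢u = cong (if_then c x else 0) (isYes-false (x Fin.≟ u) x≢u)

∑-if-cong : ∀ {n} {b b' : Fin n → Bool} (h : Fin n → ℕ) → (∀ w → b w ≡ b' w) →
  ∑[ w < n ] (if b w then h w else 0) ≡ ∑[ w < n ] (if b' w then h w else 0)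
∑-if-cong h b≗b' = sum-cong-≗ λ w → cong (if_then h w else 0) (b≗b' w)

∑-δ-either : ∀ {n} (h : Fin n → ℕ) (u v : Fin n) c d → c ∧ d ≡ false →
  ∑[ w < n ] (if (⌊ w Fin.≟ v ⌋ ∧ c) ∨ (⌊ w Fin.≟ u ⌋ ∧ d) then h w else 0) ≡
  (if d then h u else if c then h v else 0)
∑-δ-either {n} h u v false false _ = trans
  (∑-if-cong h λ w → cong₂ _∨_ (∧-zeroʳ ⌊ w Fin.≟ v ⌋) (∧-zeroʳ ⌊ w Fin.≟ u ⌋)) (sum-replicate-zero n)
∑-δ-either h u v true false _ = trans
  (∑-if-cong h λ w → trans (cong₂ _∨_ (∧-identityʳ ⌊ w Fin.≟ v ⌋) (∧-zeroʳ ⌊ w Fin.≟ u ⌋)) (∨-identityʳ _))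
  (∑-δ v h)
∑-δ-either h u v false true _ = trans
  (∑-if-cong h λ w → cong₂ _∨_ (∧-zeroʳ ⌊ w Fin.≟ v ⌋) (∧-identityʳ ⌊ w Fin.≟ u ⌋)) (∑-δ u h)

[a∧c]∨[b∧d]⇒c∨d : ∀ a b c d → (a ∧ c) ∨ (b ∧ d) ≡ true → c ∨ d ≡ true
[a∧c]∨[b∧d]⇒c∨d _     _     true  _ _  = refl
[a∧c]∨[b∧d]⇒c∨d true  true  false _ eq = eq
[a∧c]∨[b∧d]⇒c∨d false true  false _ eq = eq

module _ {A : Set} where

  sum-map-filterᵇ : ∀ (p : A → Bool) (g : A → ℕ) xs →
    sum (map g (filterᵇ p xs)) ≡ sum (map (λ x → if p x then g x else 0) xs)
  sum-map-filterᵇ p g [] = refl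
  sum-map-filterᵇ p g (x ∷ xs) with p x
  ... | true  = cong (g x +_) (sum-map-filterᵇ p g xs)
  ... | false = sum-map-filterᵇ p g xs

  length-filterᵇ : ∀ (p : A → Bool) xs → length (filterᵇ p xs) ≡ sum (map (𝟙 ∘ p) xs)
  length-filterᵇ p [] = refl
  length-filterᵇ p (x ∷ xs) with p x
  ... | true  = cong suc (length-filterᵇ p xs)
  ... | false = length-filterᵇ p xs

  filterᵇ-∧ : ∀ (p q : A → Bool) xs → filterᵇ (λ x → p x ∧ q x) xs ≡ filterᵇ q (filterᵇ p xs)
  filterᵇ-∧ p q [] = refl
  filterᵇ-∧ p q (x ∷ xs) with p x
  ... | false = filterᵇ-∧ p q xs
  ... | true with q x
  ...   | true  = cong (x ∷_) (filterᵇ-∧ p q xs)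
  ...   | false = filterᵇ-∧ p q xs

  ∈-filterᵇ⁺ : ∀ (p : A → Bool) {x xs} → x ∈ xs → p x ≡ true → x ∈ filterᵇ p xs
  ∈-filterᵇ⁺ p {xs = y ∷ ys} (here refl) py rewrite py = here refl
  ∈-filterᵇ⁺ p {xs = y ∷ ys} (there x∈ys) px with p y
  ... | true  = there (∈-filterᵇ⁺ p x∈ys px)
  ... | false = ∈-filterᵇ⁺ p x∈ys px

  sum-map-mono-≤ : ∀ {g h : A → ℕ} → (∀ x → g x ≤ h x) → ∀ xs → sum (map g xs) ≤ sum (map h xs)
  sum-map-mono-≤ g≤h []       = z≤n
  sum-map-mono-≤ g≤h (x ∷ xs) = +-mono-≤ (g≤h x) (sum-map-mono-≤ g≤h xs)

  sum-map-concatMap : ∀ {B : Set} (g : B → ℕ) (h : A → List B) xs →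
    sum (map g (concatMap h xs)) ≡ sum (map (λ x → sum (map g (h x))) xs)
  sum-map-concatMap g h [] = refl
  sum-map-concatMap g h (x ∷ xs) = begin
    sum (map g (h x ++ concatMap h xs))
      ≡⟨ cong sum (map-++ g (h x) _) ⟩
    sum (map g (h x) ++ map g (concatMap h xs))
      ≡⟨ sum-++ (map g (h x)) _ ⟩
    sum (map g (h x)) + sum (map g (concatMap h xs))
      ≡⟨ cong (sum (map g (h x)) +_) (sum-map-concatMap g h xs) ⟩
    sum (map g (h x)) + sum (map (λ x → sum (map g (h x))) xs) ∎
    where open ≡-Reasoning

sum-map-tabulate : ∀ {A : Set} {n} (g : A → ℕ) (t : Fin n → A) →
  sum (map g (tabulate t)) ≡ ∑[ i < n ] g (t i)
sum-map-tabulate {n = zero}  g t = refl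
sum-map-tabulate {n = suc n} g t = cong (g (t Fin.zero) +_) (sum-map-tabulate g (t ∘ Fin.suc))

sum-map-allFin : ∀ {n} (g : Fin n → ℕ) → sum (map g (allFin n)) ≡ ∑[ i < n ] g i
sum-map-allFin g = sum-map-tabulate g (λ i → i)

sum-map-map-allFin : ∀ {A : Set} {n} (g : A → ℕ) (h : Fin n → A) →
  sum (map g (map h (allFin n))) ≡ ∑[ i < n ] g (h i)
sum-map-map-allFin g h = trans (cong (sum ∘ map g) (map-tabulate (λ i → i) h)) (sum-map-tabulate g h)

module _ {A : Set} (g : A → ℕ) where

  ∈⇒≤sum-map : ∀ {x xs} → x ∈ xs → g x ≤ sum (map g xs)
  ∈⇒≤sum-map {xs = _ ∷ xs} (here refl)  = m≤m+n _ (sum (map g xs))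
  ∈⇒≤sum-map {xs = y ∷ _}  (there x∈xs) = m≤n⇒m≤o+n (g y) (∈⇒≤sum-map x∈xs)

  strong-∈⇒dominated : ∀ k {x xs} → x ∈ xs → g x ≡ suc k →
    k + sum (map (signum ∘ g) xs) ≤ sum (map g xs)
  strong-∈⇒dominated k {xs = _ ∷ xs} (here refl) gx≡1+k rewrite gx≡1+k =
    ≤-trans (≤-reflexive (+-suc k _)) (s≤s (+-monoʳ-≤ k (sum-map-mono-≤ (signum≤id ∘ g) xs)))
  strong-∈⇒dominated k {xs = y ∷ _} (there x∈xs) gx≡1+k =
    ≤-trans (≤-reflexive (x∙yz≈y∙xz k (signum (g y)) _))
            (+-mono-≤ (signum≤id (g y)) (strong-∈⇒dominated k x∈xs gx≡1+k))

1≤ᵇ-true : ∀ {y} → 1 ≤ y → (1 ≤ᵇ y) ≡ true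
1≤ᵇ-true {suc y} _ = refl

module _ (H : FinGraph) where

  cardAN≡sumN-signum : ∀ f v → cardAN H f v ≡ sumN H (signum ∘ f) v
  cardAN≡sumN-signum f v =
    trans (cong length (filterᵇ-∧ (adj H v) (λ w → 1 ≤ᵇ f w) (vs H)))
          (length-filterᵇ (λ w → 1 ≤ᵇ f w) (filterᵇ (adj H v) (vs H)))

  IsKRDF⇒dominated : ∀ {k f} → IsKRDF H k f → ∀ v → k + cardAN H f v ≤ f v + sumN H f v
  IsKRDF⇒dominated {k} {f} (_ , dominated) v with f v <? k
  ... | yes fv<k = dominated v fv<k
  ... | no  fv≮k = +-mono-≤ (≮⇒≥ fv≮k) (≤-trans (≤-reflexive (cardAN≡sumN-signum f v))
                                                 (sum-map-mono-≤ (signum≤id ∘ f) (filterᵇ (adj H v) (vs H))))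

  positive-neighbour⇒1≤cardAN : ∀ {f v w} → w ∈ vs H → adj H v w ≡ true → 1 ≤ f w → 1 ≤ cardAN H f v
  positive-neighbour⇒1≤cardAN {f} {v} {w} w∈V vw 1≤fw = begin
    1                      ≡⟨ cong 𝟙 (1≤ᵇ-true 1≤fw) ⟨
    signum (f w)           ≤⟨ ∈⇒≤sum-map (signum ∘ f) (∈-filterᵇ⁺ (adj H v) w∈V vw) ⟩
    sumN H (signum ∘ f) v  ≡⟨ cardAN≡sumN-signum f v ⟨
    cardAN H f v           ∎
    where open ≤-Reasoning

  strong-neighbour⇒dominated : ∀ {k f v w} → w ∈ vs H → adj H v w ≡ true → f w ≡ suc k →
    k + cardAN H f v ≤ sumN H f v
  strong-neighbour⇒dominated {k} {f} {v} w∈V vw fw≡1+k =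
    subst (λ c → k + c ≤ sumN H f v) (sym (cardAN≡sumN-signum f v))
      (strong-∈⇒dominated f k (∈-filterᵇ⁺ (adj H v) w∈V vw) fw≡1+k)

data Level : Set where
  off on strong : Level

value : ℕ → Level → ℕ
value k off    = 0
value k on     = k
value k strong = suc k

_≟ᴸ_ : DecidableEquality Level
off    ≟ᴸ off    = yes refl
off    ≟ᴸ on     = no λ ()
off    ≟ᴸ strong = no λ ()
on     ≟ᴸ off    = no λ ()
on     ≟ᴸ on     = yes refl
on     ≟ᴸ strong = no λ ()
strong ≟ᴸ off    = no λ ()
strong ≟ᴸ on     = no λ ()
strong ≟ᴸ strong = yes refl

module _ (H : FinGraph) (k : ℕ) (ℓ : V H → Level) where

  levels-IsKRDF : (∀ v → v ∈ vs H) → (∀ v → ℓ v ≡ off → ∃[ w ] adj H v w ≡ true × ℓ w ≡ strong) →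
    IsKRDF H k (value k ∘ ℓ)
  levels-IsKRDF complete supported = bounded , dominated
    where
    bounded : ∀ v → value k (ℓ v) ≤ suc k
    bounded v with ℓ v
    ... | off    = z≤n
    ... | on     = n≤1+n k
    ... | strong = ≤-refl
    dominated : ∀ v → value k (ℓ v) < k →
      k + cardAN H (value k ∘ ℓ) v ≤ value k (ℓ v) + sumN H (value k ∘ ℓ) v
    dominated v v<k with ℓ v in ℓv
    ... | off    = let w , vw , ℓw = supported v ℓv in
                   strong-neighbour⇒dominated H (complete w) vw (cong (value k) ℓw)
    ... | on     = contradiction v<k (n≮n k)
    ... | strong = contradiction (<-trans (n<1+n k) v<k) (n≮n k)

  levels-PositiveIndependent : (∀ v w → adj H v w ≡ true → ℓ v ≡ off ⊎ ℓ w ≡ off) →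
    PositiveIndependent H (value k ∘ ℓ)
  levels-PositiveIndependent independent v w vw =
    Sum.map (cong (value k)) (cong (value k)) (independent v w vw)

uEnd vEnd : (G : EGraph) → Fin (m G) → Fin (n G)
uEnd G e = proj₁ (ends G e)
vEnd G e = proj₂ (ends G e)

uncovered : (G : EGraph) → (Fin (n G) → Bool) → Fin (m G) → Bool
uncovered G W e = not (W (uEnd G e)) ∧ not (W (vEnd G e))

coverSize≡∑ : ∀ G S → coverSize G S ≡ ∑[ x < n G ] 𝟙 (S x)
coverSize≡∑ G S = trans (length-filterᵇ S (allFin (n G))) (sum-map-allFin (𝟙 ∘ S))

τ≤size+uncovered : ∀ {G t} → Tau≡ G t → ∀ W →
  t ≤ coverSize G W + ∑[ e < m G ] 𝟙 (uncovered G W e)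
τ≤size+uncovered {G} (_ , minimal) W =
  ≤-trans (minimal _ (patched , patched-covers , refl)) patched-size
  where
  extra : Fin (n G) → ℕ
  extra x = ∑[ e < m G ] (if ⌊ x Fin.≟ uEnd G e ⌋ then 𝟙 (uncovered G W e) else 0)

  patched : Fin (n G) → Bool
  patched x = W x ∨ (1 ≤ᵇ extra x)

  patched-covers : IsVertexCover G patched
  patched-covers e with W (uEnd G e) in Wu | W (vEnd G e) in Wv
  ... | true  | _     = inj₁ refl
  ... | false | true  = inj₂ refl
  ... | false | false = inj₁ (1≤ᵇ-true extra≥1)
    where
    extra≥1 : 1 ≤ extra (uEnd G e)
    extra≥1 = ≤-trans (≤-reflexive (sym (cong₂ (λ b c → if b then 𝟙 c else 0)
                        (isYes-true (uEnd G e Fin.≟ uEnd G e) refl)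
                        (cong₂ (λ a b → not a ∧ not b) Wu Wv))))
                      (∑-term-≤ _ e)

  patched-size : coverSize G patched ≤ coverSize G W + ∑[ e < m G ] 𝟙 (uncovered G W e)
  patched-size = begin
    coverSize G patched                                  ≡⟨ coverSize≡∑ G patched ⟩
    ∑[ x < n G ] 𝟙 (patched x)                           ≤⟨ ∑-mono-≤ pointwise ⟩
    ∑[ x < n G ] (𝟙 (W x) + extra x)                     ≡⟨ ∑-distrib-+ (𝟙 ∘ W) extra ⟩
    ∑[ x < n G ] 𝟙 (W x) + ∑[ x < n G ] extra x          ≡⟨ cong₂ _+_ (coverSize≡∑ G W) extra-total ⟨
    coverSize G W + ∑[ e < m G ] 𝟙 (uncovered G W e)     ∎
    where
    open ≤-Reasoning
    pointwise : ∀ x → 𝟙 (patched x) ≤ 𝟙 (W x) + extra x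
    pointwise x with W x
    ... | true  = s≤s z≤n
    ... | false = signum≤id (extra x)
    extra-total : ∑[ e < m G ] 𝟙 (uncovered G W e) ≡ ∑[ x < n G ] extra x
    extra-total = trans (sum-cong-≗ λ e → sym (∑-δ (uEnd G e) _))
                        (∑-comm (λ e x → if ⌊ x Fin.≟ uEnd G e ⌋ then 𝟙 (uncovered G W e) else 0))

-- The neighbours of x j within G_e ∪ {u, v}, where x j is the paper's x_{j+1} and a, b are u, v.
gadgetNbrs : ∀ {A : Set} → A → A → (Fin 10 → A) → Fin 10 → List A
gadgetNbrs a b x 0F = a ∷ x 1F ∷ []
gadgetNbrs a b x 1F = x 0F ∷ x 2F ∷ x 6F ∷ []
gadgetNbrs a b x 2F = x 1F ∷ x 3F ∷ []
gadgetNbrs a b x 3F = x 2F ∷ x 4F ∷ x 8F ∷ []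
gadgetNbrs a b x 4F = b ∷ x 3F ∷ []
gadgetNbrs a b x 5F = x 6F ∷ []
gadgetNbrs a b x 6F = x 1F ∷ x 5F ∷ x 7F ∷ []
gadgetNbrs a b x 7F = x 6F ∷ x 8F ∷ []
gadgetNbrs a b x 8F = x 3F ∷ x 7F ∷ x 9F ∷ []
gadgetNbrs a b x 9F = x 8F ∷ []

gadgetAdj : Fin 10 → Fin 10 → Bool
gadgetAdj i j = internal (toℕ i) (toℕ j) ∨ internal (toℕ j) (toℕ i)

hasIndex : Fin 10 → ℕ → Bool
hasIndex j c = ⌊ toℕ j ℕ.≟ c ⌋

isPort : Fin 10 → Bool
isPort j = hasIndex j 0 ∨ hasIndex j 4

ports-disjoint : ∀ j → hasIndex j 4 ∧ hasIndex j 0 ≡ false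
ports-disjoint = from-yes (all? λ j → (hasIndex j 4 ∧ hasIndex j 0) Bool.≟ false)

sum-gadgetNbrs : ∀ {A : Set} (g : A → ℕ) a b (x : Fin 10 → A) j →
  (if hasIndex j 0 then g a else if hasIndex j 4 then g b else 0) +
  ∑[ j' < 10 ] (if gadgetAdj j j' then g (x j') else 0) ≡ sum (map g (gadgetNbrs a b x j))
sum-gadgetNbrs g a b x 0F = refl
sum-gadgetNbrs g a b x 1F = refl
sum-gadgetNbrs g a b x 2F = refl
sum-gadgetNbrs g a b x 3F = refl
sum-gadgetNbrs g a b x 4F = refl
sum-gadgetNbrs g a b x 5F = refl
sum-gadgetNbrs g a b x 6F = refl
sum-gadgetNbrs g a b x 7F = refl
sum-gadgetNbrs g a b x 8F = refl
sum-gadgetNbrs g a b x 9F = refl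

∑-at-ports : ∀ p q (x : Fin 10 → ℕ) →
  ∑[ j < 10 ] (if (p ∧ hasIndex j 0) ∨ (q ∧ hasIndex j 4) then x j else 0) ≡
  (if p then x 0F else 0) + (if q then x 4F else 0)
∑-at-ports true  true  x = cong (x 0F +_) (+-identityʳ (x 4F))
∑-at-ports true  false x = refl
∑-at-ports false true  x = +-identityʳ (x 4F)
∑-at-ports false false x = refl

Dominated : ℕ → ℕ → List ℕ → Set
Dominated k s ns = k + sum (map signum ns) ≤ s + sum ns

gadgetCore : (Fin 10 → ℕ) → ℕ
gadgetCore x = x 1F + x 2F + x 3F + x 5F + x 6F + x 7F + x 8F + x 9F

∑-gadget-split : ∀ x → ∑[ j < 10 ] x j ≡ x 0F + x 4F + gadgetCore x
∑-gadget-split x = regroup (x 0F) (x 1F) (x 2F) (x 3F) (x 4F) (x 5F) (x 6F) (x 7F) (x 8F) (x 9F)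
  where
  regroup : ∀ a₀ a₁ a₂ a₃ a₄ a₅ a₆ a₇ a₈ a₉ →
    a₀ + (a₁ + (a₂ + (a₃ + (a₄ + (a₅ + (a₆ + (a₇ + (a₈ + (a₉ + 0))))))))) ≡
    a₀ + a₄ + (a₁ + a₂ + a₃ + a₅ + a₆ + a₇ + a₈ + a₉)
  regroup = solve-∀

gadgetCore-partition : ∀ x → gadgetCore x ≡
  (x 2F + sum (x 1F ∷ x 3F ∷ [])) + (x 5F + sum (x 6F ∷ [])) + (x 9F + sum (x 8F ∷ [])) + x 7F
gadgetCore-partition x = regroup (x 1F) (x 2F) (x 3F) (x 5F) (x 6F) (x 7F) (x 8F) (x 9F)
  where
  regroup : ∀ a₁ a₂ a₃ a₅ a₆ a₇ a₈ a₉ →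
    a₁ + a₂ + a₃ + a₅ + a₆ + a₇ + a₈ + a₉ ≡
    (a₂ + (a₁ + (a₃ + 0))) + (a₅ + (a₆ + 0)) + (a₉ + (a₈ + 0)) + a₇
  regroup = solve-∀

module _ (k : ℕ) where

  three-groups : ∀ {p q r c A B C d} → d ≤ p + q + r + c →
    k + p ≤ A → k + q ≤ B → k + r ≤ C → 3 * k + d ≤ A + B + C + c
  three-groups {p} {q} {r} {c} {A} {B} {C} {d} d≤ kp kq kr = begin
    3 * k + d                        ≤⟨ +-monoʳ-≤ (3 * k) d≤ ⟩
    3 * k + (p + q + r + c)          ≡⟨ regroup k p q r c ⟩
    (k + p) + (k + q) + (k + r) + c  ≤⟨ +-monoˡ-≤ c (+-mono-≤ (+-mono-≤ kp kq) kr) ⟩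
    A + B + C + c                    ∎
    where
    open ≤-Reasoning
    regroup : ∀ k p q r c → 3 * k + (p + q + r + c) ≡ (k + p) + (k + q) + (k + r) + c
    regroup = solve-∀

  shrink-surplus : ∀ {p p' A} → p' ≤ p → k + p ≤ A → k + p' ≤ A
  shrink-surplus p'≤p = ≤-trans (+-monoʳ-≤ k p'≤p)

  +0-cancel : ∀ {x} → k + 0 ≤ x + 0 → k ≤ x
  +0-cancel {x} = subst₂ _≤_ (+-identityʳ k) (+-identityʳ x)

  -- The + 0 makes the conclusion match a closed sum such as x₉ + sum (0 ∷ []) by computation.
  sole-neighbour : ∀ {y} → 1 ≤ k → Dominated k 0 (y ∷ []) → k + 1 ≤ y + 0
  sole-neighbour {zero}  k≥1 h = contradiction (≤-trans k≥1 (+0-cancel h)) λ ()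
  sole-neighbour {suc y} k≥1 h = h

  ¬dominated-by-light-end : ∀ {a} → 1 ≤ k → a ≤ k → ¬ Dominated k 0 (a ∷ 0 ∷ [])
  ¬dominated-by-light-end {zero}  k≥1 _   h = contradiction (≤-trans k≥1 (+0-cancel h)) λ ()
  ¬dominated-by-light-end {suc a} _   a≤k h =
    m+1+n≰m k (≤-trans h (≤-trans (≤-reflexive (+-identityʳ (suc a))) a≤k))

-- Each of the three closed neighbourhoods has surplus one per positive neighbour; when the surpluses
-- and x₇ give less than 2, the bound at x₇, x₈ or x₆ forces x₇ ≥ k, x₉ > k or x₅ > k instead.
core-lower : ∀ k {x₁ x₂ x₃ x₅ x₆ x₇ x₈ x₉} → 2 ≤ k →
  Dominated k x₂ (x₁ ∷ x₃ ∷ []) → Dominated k x₅ (x₆ ∷ []) → Dominated k x₆ (x₁ ∷ x₅ ∷ x₇ ∷ []) →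
  Dominated k x₇ (x₆ ∷ x₈ ∷ []) → Dominated k x₈ (x₃ ∷ x₇ ∷ x₉ ∷ []) → Dominated k x₉ (x₈ ∷ []) →
  3 * k + 2 ≤ (x₂ + sum (x₁ ∷ x₃ ∷ [])) + (x₅ + sum (x₆ ∷ [])) + (x₉ + sum (x₈ ∷ [])) + x₇
core-lower k {x₆ = suc _} {x₈ = suc _} _ h₂ h₅ _ _ _ h₉ =
  three-groups k (s≤s (s≤s z≤n)) (shrink-surplus k z≤n h₂) h₅ h₉
core-lower k {x₆ = zero} {x₈ = zero} k≥2 h₂ h₅ _ h₇ _ h₉ =
  three-groups k (≤-trans k≥2 (+0-cancel k h₇)) (shrink-surplus k z≤n h₂) h₅ h₉
core-lower k {x₆ = suc _} {x₇ = suc _} {x₈ = zero} _ h₂ h₅ _ _ _ h₉ =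
  three-groups k (s≤s (s≤s z≤n)) (shrink-surplus k z≤n h₂) h₅ h₉
core-lower k {x₁ = x₁} {x₃ = suc _} {x₆ = suc _} {x₇ = zero} {x₈ = zero} _ h₂ h₅ _ _ _ h₉ =
  three-groups k (s≤s (s≤s z≤n)) (shrink-surplus k (m≤n+m 1 (signum x₁)) h₂) h₅ h₉
core-lower k {x₃ = zero} {x₆ = suc _} {x₇ = zero} {x₈ = zero} k≥2 h₂ h₅ _ _ h₈ _ =
  three-groups k (s≤s (s≤s z≤n)) (shrink-surplus k z≤n h₂) h₅ (sole-neighbour k (≤-trans (s≤s z≤n) k≥2) h₈)
core-lower k {x₆ = zero} {x₇ = suc _} {x₈ = suc _} _ h₂ h₅ _ _ _ h₉ =
  three-groups k (s≤s (s≤s z≤n)) (shrink-surplus k z≤n h₂) h₅ h₉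
core-lower k {x₁ = suc _} {x₆ = zero} {x₇ = zero} {x₈ = suc _} _ h₂ h₅ _ _ _ h₉ =
  three-groups k (s≤s (s≤s z≤n)) (shrink-surplus k (s≤s z≤n) h₂) h₅ h₉
core-lower k {x₁ = zero} {x₆ = zero} {x₇ = zero} {x₈ = suc _} k≥2 h₂ _ h₆ _ _ h₉ =
  three-groups k (s≤s (s≤s z≤n)) (shrink-surplus k z≤n h₂) (sole-neighbour k (≤-trans (s≤s z≤n) k≥2) h₆) h₉

core-lower-light : ∀ k {a b x₁ x₂ x₃ x₅ x₆ x₇ x₈ x₉} → 1 ≤ k → a ≤ k → b ≤ k →
  Dominated k 0 (a ∷ x₁ ∷ []) → Dominated k 0 (b ∷ x₃ ∷ []) →
  Dominated k x₂ (x₁ ∷ x₃ ∷ []) → Dominated k x₅ (x₆ ∷ []) →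
  Dominated k x₇ (x₆ ∷ x₈ ∷ []) → Dominated k x₉ (x₈ ∷ []) →
  3 * k + 3 ≤ (x₂ + sum (x₁ ∷ x₃ ∷ [])) + (x₅ + sum (x₆ ∷ [])) + (x₉ + sum (x₈ ∷ [])) + x₇
core-lower-light k {x₁ = zero} k≥1 a≤k _ h₀ _ _ _ _ _ = contradiction h₀ (¬dominated-by-light-end k k≥1 a≤k)
core-lower-light k {x₃ = zero} k≥1 _ b≤k _ h₄ _ _ _ _ = contradiction h₄ (¬dominated-by-light-end k k≥1 b≤k)
core-lower-light k {x₁ = suc _} {x₃ = suc _} {x₆ = suc _} _ _ _ _ _ h₂ h₅ _ h₉ =
  three-groups k (s≤s (s≤s (s≤s z≤n))) h₂ h₅ h₉
core-lower-light k {x₁ = suc _} {x₃ = suc _} {x₆ = zero} {x₈ = suc _} _ _ _ _ _ h₂ h₅ _ h₉ =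
  three-groups k (s≤s (s≤s (s≤s z≤n))) h₂ h₅ h₉
core-lower-light k {x₁ = suc _} {x₃ = suc _} {x₆ = zero} {x₈ = zero} k≥1 _ _ _ _ h₂ h₅ h₇ h₉ =
  three-groups k (s≤s (s≤s (≤-trans k≥1 (+0-cancel k h₇)))) h₂ h₅ h₉

gadget-core-lower : ∀ {k} {A : Set} (f : A → ℕ) a b (x : Fin 10 → A) → 2 ≤ k →
  (∀ j → Dominated k (f (x j)) (map f (gadgetNbrs a b x j))) → 3 * k + 2 ≤ gadgetCore (f ∘ x)
gadget-core-lower {k} f a b x k≥2 dom =
  subst (3 * k + 2 ≤_) (sym (gadgetCore-partition (f ∘ x)))
    (core-lower k {y 1F} {y 2F} {y 3F} {y 5F} {y 6F} {y 7F} {y 8F} {y 9F} k≥2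
      (dom 2F) (dom 5F) (dom 6F) (dom 7F) (dom 8F) (dom 9F))
  where
  y : Fin 10 → ℕ
  y = f ∘ x

gadget-core-lower-light : ∀ {k} {A : Set} (f : A → ℕ) a b (x : Fin 10 → A) → 1 ≤ k →
  f a ≤ k → f b ≤ k → f (x 0F) ≡ 0 → f (x 4F) ≡ 0 →
  (∀ j → Dominated k (f (x j)) (map f (gadgetNbrs a b x j))) → 3 * k + 3 ≤ gadgetCore (f ∘ x)
gadget-core-lower-light {k} f a b x k≥1 a≤k b≤k x₀≡0 x₄≡0 dom =
  subst (3 * k + 3 ≤_) (sym (gadgetCore-partition (f ∘ x)))
    (core-lower-light k {f a} {f b} {y 1F} {y 2F} {y 3F} {y 5F} {y 6F} {y 7F} {y 8F} {y 9F} k≥1 a≤k b≤k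
      (subst (λ s → Dominated k s (f a ∷ y 1F ∷ [])) x₀≡0 (dom 0F))
      (subst (λ s → Dominated k s (f b ∷ y 3F ∷ [])) x₄≡0 (dom 4F))
      (dom 2F) (dom 5F) (dom 7F) (dom 9F))
  where
  y : Fin 10 → ℕ
  y = f ∘ x

record GadgetPattern (p : Fin 10 → Level) (port : Fin 10) : Set where
  field
    ports-off   : ∀ j → isPort j ≡ true → p j ≡ off
    independent : ∀ i j → gadgetAdj i j ≡ true → p i ≡ off ⊎ p j ≡ off
    supported   : ∀ j → p j ≡ off → j ≡ port ⊎ ∃[ j' ] gadgetAdj j j' ≡ true × p j' ≡ strong
    value-sum   : ∀ k → ∑[ j < 10 ] value k (p j) ≡ 3 * k + 2

ports-off? : (p : Fin 10 → Level) → Dec (∀ j → isPort j ≡ true → p j ≡ off)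
ports-off? p = all? λ j → (isPort j Bool.≟ true) →-dec (p j ≟ᴸ off)

independent? : (p : Fin 10 → Level) → Dec (∀ i j → gadgetAdj i j ≡ true → p i ≡ off ⊎ p j ≡ off)
independent? p = all? λ i → all? λ j → (gadgetAdj i j Bool.≟ true) →-dec (p i ≟ᴸ off ⊎-dec p j ≟ᴸ off)

supported? : (p : Fin 10 → Level) (port : Fin 10) →
  Dec (∀ j → p j ≡ off → j ≡ port ⊎ ∃[ j' ] gadgetAdj j j' ≡ true × p j' ≡ strong)
supported? p port = all? λ j → (p j ≟ᴸ off) →-dec
  ((j Fin.≟ port) ⊎-dec any? λ j' → (gadgetAdj j j' Bool.≟ true) ×-dec (p j' ≟ᴸ strong))

-- patternU labels G_e when u is in the cover; patternV is its mirror image, for v.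
patternU : Fin 10 → Level
patternU 3F = strong
patternU 6F = strong
patternU 9F = on
patternU _  = off

patternV : Fin 10 → Level
patternV 1F = strong
patternV 8F = strong
patternV 5F = on
patternV _  = off

patternU-valid : GadgetPattern patternU 0F
patternU-valid = record
  { ports-off   = from-yes (ports-off? patternU)
  ; independent = from-yes (independent? patternU)
  ; supported   = from-yes (supported? patternU 0F)
  ; value-sum   = normalised
  }
  where
  normalised : ∀ k → suc k + (suc k + (k + 0)) ≡ 3 * k + 2
  normalised = solve-∀

patternV-valid : GadgetPattern patternV 4F
patternV-valid = record
  { ports-off   = from-yes (ports-off? patternV)
  ; independent = from-yes (independent? patternV)
  ; supported   = from-yes (supported? patternV 4F)
  ; value-sum   = normalised
  }
  where
  normalised : ∀ k → suc k + (k + (suc k + 0)) ≡ 3 * k + 2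
  normalised = solve-∀

pattern-for : ∀ b → GadgetPattern (if b then patternU else patternV) (if b then 0F else 4F)
pattern-for true  = patternU-valid
pattern-for false = patternV-valid

module _ (G : EGraph) where

  gadget : Fin (m G) → Fin 10 → VF G
  gadget e j = inj₂ (e , j)

  gadgetNbrsF : Fin (m G) → Fin 10 → List (VF G)
  gadgetNbrsF e = gadgetNbrs (inj₁ (uEnd G e)) (inj₁ (vEnd G e)) (gadget e)

  vs-complete : ∀ x → x ∈ vs (F G)
  vs-complete (inj₁ w)       = ∈-++⁺ˡ (∈-map⁺ inj₁ (∈-allFin w))
  vs-complete (inj₂ (e , j)) =
    ∈-++⁺ʳ _ (∈-concat⁺′ (∈-map⁺ (gadget e) (∈-allFin j)) (∈-map⁺ _ (∈-allFin e)))

  sum-vs : ∀ g → sum (map g (vs (F G))) ≡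
    ∑[ w < n G ] g (inj₁ w) + ∑[ e < m G ] ∑[ j < 10 ] g (gadget e j)
  sum-vs g = begin
    sum (map g (vertices ++ gadgets))           ≡⟨ cong sum (map-++ g vertices gadgets) ⟩
    sum (map g vertices ++ map g gadgets)       ≡⟨ sum-++ (map g vertices) (map g gadgets) ⟩
    sum (map g vertices) + sum (map g gadgets)  ≡⟨ cong₂ _+_ (sum-map-map-allFin g inj₁) gadget-part ⟩
    ∑[ w < n G ] g (inj₁ w) + ∑[ e < m G ] ∑[ j < 10 ] g (gadget e j) ∎
    where
    open ≡-Reasoning
    vertices gadgets : List (VF G)
    vertices = map inj₁ (allFin (n G))
    gadgets  = concatMap (λ e → map (gadget e) (allFin 10)) (allFin (m G))
    gadget-part : sum (map g gadgets) ≡ ∑[ e < m G ] ∑[ j < 10 ] g (gadget e j)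
    gadget-part = trans (sum-map-concatMap g _ (allFin (m G)))
      (trans (sum-map-allFin (λ e → sum (map g (map (gadget e) (allFin 10)))))
             (sum-cong-≗ λ e → sum-map-map-allFin g (gadget e)))

  adj-sym : ∀ x y → adj (F G) x y ≡ adj (F G) y x
  adj-sym x y = ∨-comm (arcF G x y) (arcF G y x)

  adj-uEnd-port : ∀ e → adj (F G) (inj₁ (uEnd G e)) (gadget e 0F) ≡ true
  adj-uEnd-port e rewrite isYes-true (uEnd G e Fin.≟ uEnd G e) refl = refl

  adj-vEnd-port : ∀ e → adj (F G) (inj₁ (vEnd G e)) (gadget e 4F) ≡ true
  adj-vEnd-port e rewrite isYes-true (vEnd G e Fin.≟ vEnd G e) refl = ∨-zeroʳ _

  adj-gadget-same : ∀ e i j → adj (F G) (gadget e i) (gadget e j) ≡ gadgetAdj i j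
  adj-gadget-same e i j rewrite isYes-true (e Fin.≟ e) refl = refl

  adj-gadget-≢ : ∀ {e e'} i j → e ≢ e' → adj (F G) (gadget e i) (gadget e' j) ≡ false
  adj-gadget-≢ {e} {e'} i j e≢e'
    rewrite isYes-false (e Fin.≟ e') e≢e' | isYes-false (e' Fin.≟ e) (e≢e' ∘ sym) = refl

  adj-vertex-gadget⇒port : ∀ w e j → adj (F G) (inj₁ w) (gadget e j) ≡ true → isPort j ≡ true
  adj-vertex-gadget⇒port w e j =
    [a∧c]∨[b∧d]⇒c∨d ⌊ w Fin.≟ uEnd G e ⌋ ⌊ w Fin.≟ vEnd G e ⌋ (hasIndex j 0) (hasIndex j 4)

  sumN-gadget : ∀ g e j → sumN (F G) g (gadget e j) ≡ sum (map g (gadgetNbrsF e j))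
  sumN-gadget g e j = begin
    sumN (F G) g (gadget e j)
      ≡⟨ sum-map-filterᵇ (adj (F G) (gadget e j)) g (vs (F G)) ⟩
    sum (map (λ y → if adj (F G) (gadget e j) y then g y else 0) (vs (F G)))
      ≡⟨ sum-vs _ ⟩
    ∑[ w < n G ] (if adj (F G) (gadget e j) (inj₁ w) then g (inj₁ w) else 0) +
    ∑[ e' < m G ] ∑[ j' < 10 ] (if adj (F G) (gadget e j) (gadget e' j') then g (gadget e' j') else 0)
      ≡⟨ cong₂ _+_ (∑-δ-either (g ∘ inj₁) (uEnd G e) (vEnd G e) _ _ (ports-disjoint j)) same-gadget ⟩
    (if hasIndex j 0 then g (inj₁ (uEnd G e)) else if hasIndex j 4 then g (inj₁ (vEnd G e)) else 0) +
    ∑[ j' < 10 ] (if gadgetAdj j j' then g (gadget e j') else 0)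
      ≡⟨ sum-gadgetNbrs g (inj₁ (uEnd G e)) (inj₁ (vEnd G e)) (gadget e) j ⟩
    sum (map g (gadgetNbrsF e j)) ∎
    where
    open ≡-Reasoning
    same-gadget :
      ∑[ e' < m G ] ∑[ j' < 10 ] (if adj (F G) (gadget e j) (gadget e' j') then g (gadget e' j') else 0) ≡
      ∑[ j' < 10 ] (if gadgetAdj j j' then g (gadget e j') else 0)
    same-gadget = trans
      (∑-supported _ e λ e' e'≢e →
        trans (∑-if-cong (g ∘ gadget e') λ j' → adj-gadget-≢ j j' (e'≢e ∘ sym)) (sum-replicate-zero 10))
      (∑-if-cong (g ∘ gadget e) (adj-gadget-same e j))

  sumN-vertex : ∀ g w → sumN (F G) g (inj₁ w) ≡
    ∑[ e < m G ] ((if ⌊ w Fin.≟ uEnd G e ⌋ then g (gadget e 0F) else 0) +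
                  (if ⌊ w Fin.≟ vEnd G e ⌋ then g (gadget e 4F) else 0))
  sumN-vertex g w = begin
    sumN (F G) g (inj₁ w)
      ≡⟨ sum-map-filterᵇ (adj (F G) (inj₁ w)) g (vs (F G)) ⟩
    sum (map (λ y → if adj (F G) (inj₁ w) y then g y else 0) (vs (F G)))
      ≡⟨ sum-vs _ ⟩
    ∑[ w' < n G ] 0 +
    ∑[ e < m G ] ∑[ j < 10 ] (if adj (F G) (inj₁ w) (gadget e j) then g (gadget e j) else 0)
      ≡⟨ cong₂ _+_ (sum-replicate-zero (n G))
           (sum-cong-≗ λ e → ∑-at-ports ⌊ w Fin.≟ uEnd G e ⌋ ⌊ w Fin.≟ vEnd G e ⌋ (g ∘ gadget e)) ⟩
    ∑[ e < m G ] ((if ⌊ w Fin.≟ uEnd G e ⌋ then g (gadget e 0F) else 0) +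
                  (if ⌊ w Fin.≟ vEnd G e ⌋ then g (gadget e 4F) else 0)) ∎
    where open ≡-Reasoning

  ∑-sumN-vertices : ∀ g →
    ∑[ w < n G ] sumN (F G) g (inj₁ w) ≡ ∑[ e < m G ] (g (gadget e 0F) + g (gadget e 4F))
  ∑-sumN-vertices g = begin
    ∑[ w < n G ] sumN (F G) g (inj₁ w)
      ≡⟨ sum-cong-≗ (sumN-vertex g) ⟩
    ∑[ w < n G ] ∑[ e < m G ] incidence w e
      ≡⟨ ∑-comm incidence ⟩
    ∑[ e < m G ] ∑[ w < n G ] incidence w e
      ≡⟨ sum-cong-≗ (λ e → trans (∑-distrib-+ (λ w → at-u w e) (λ w → at-v w e))
                                   (cong₂ _+_ (∑-δ (uEnd G e) _) (∑-δ (vEnd G e) _))) ⟩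
    ∑[ e < m G ] (g (gadget e 0F) + g (gadget e 4F)) ∎
    where
    open ≡-Reasoning
    at-u at-v incidence : Fin (n G) → Fin (m G) → ℕ
    at-u w e = if ⌊ w Fin.≟ uEnd G e ⌋ then g (gadget e 0F) else 0
    at-v w e = if ⌊ w Fin.≟ vEnd G e ⌋ then g (gadget e 4F) else 0
    incidence w e = at-u w e + at-v w e

  weight-F : ∀ g → weight (F G) g ≡
    ∑[ w < n G ] (g (inj₁ w) + sumN (F G) g (inj₁ w)) + ∑[ e < m G ] gadgetCore (g ∘ gadget e)
  weight-F g = begin
    weight (F G) g
      ≡⟨ sum-vs g ⟩
    ∑[ w < n G ] g (inj₁ w) + ∑[ e < m G ] ∑[ j < 10 ] g (gadget e j)
      ≡⟨ cong (∑[ w < n G ] g (inj₁ w) +_)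
           (trans (sum-cong-≗ (∑-gadget-split ∘ (λ e → g ∘ gadget e)))
                  (∑-distrib-+ (λ e → g (gadget e 0F) + g (gadget e 4F)) (λ e → gadgetCore (g ∘ gadget e)))) ⟩
    ∑[ w < n G ] g (inj₁ w) + (∑[ e < m G ] (g (gadget e 0F) + g (gadget e 4F)) + cores)
      ≡⟨ cong (λ s → ∑[ w < n G ] g (inj₁ w) + (s + cores)) (∑-sumN-vertices g) ⟨
    ∑[ w < n G ] g (inj₁ w) + (∑[ w < n G ] sumN (F G) g (inj₁ w) + cores)
      ≡⟨ +-assoc (∑[ w < n G ] g (inj₁ w)) (∑[ w < n G ] sumN (F G) g (inj₁ w)) cores ⟨
    ∑[ w < n G ] g (inj₁ w) + ∑[ w < n G ] sumN (F G) g (inj₁ w) + cores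
      ≡⟨ cong (_+ cores) (∑-distrib-+ (g ∘ inj₁) (λ w → sumN (F G) g (inj₁ w))) ⟨
    ∑[ w < n G ] (g (inj₁ w) + sumN (F G) g (inj₁ w)) + cores ∎
    where
    open ≡-Reasoning
    cores : ℕ
    cores = ∑[ e < m G ] gadgetCore (g ∘ gadget e)

  IsKRDF⇒gadget-dominated : ∀ {k f} → IsKRDF (F G) k f →
    ∀ e j → Dominated k (f (gadget e j)) (map f (gadgetNbrsF e j))
  IsKRDF⇒gadget-dominated {k} {f} isKRDF e j =
    subst₂ _≤_ (cong (k +_) cardAN≡) (cong (f (gadget e j) +_) (sumN-gadget f e j))
      (IsKRDF⇒dominated (F G) isKRDF (gadget e j))
    where
    cardAN≡ : cardAN (F G) f (gadget e j) ≡ sum (map signum (map f (gadgetNbrsF e j)))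
    cardAN≡ = trans (cardAN≡sumN-signum (F G) f (gadget e j))
                (trans (sumN-gadget (signum ∘ f) e j) (cong sum (map-∘ (gadgetNbrsF e j))))

module LowerBound (k : ℕ) (k≥2 : 2 ≤ k) (G : EGraph) (f : VF G → ℕ) (isKRDF : IsKRDF (F G) k f) where

  closed : Fin (n G) → ℕ
  closed w = f (inj₁ w) + sumN (F G) f (inj₁ w)

  heavy : Fin (n G) → Bool
  heavy w = ⌊ k <? closed w ⌋

  k+heavy≤closed : ∀ w → k + 𝟙 (heavy w) ≤ closed w
  k+heavy≤closed w with k <? closed w
  ... | yes k<closed = ≤-trans (≤-reflexive (+-comm k 1)) k<closed
  ... | no  _        = ≤-trans (≤-reflexive (+-identityʳ k))
                               (m+n≤o⇒m≤o k (IsKRDF⇒dominated (F G) isKRDF (inj₁ w)))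

  light⇒closed≤k : ∀ {w} → heavy w ≡ false → closed w ≤ k
  light⇒closed≤k {w} light with k <? closed w
  ... | no k≮closed = ≮⇒≥ k≮closed

  light⇒neighbour-zero : ∀ {w y} → heavy w ≡ false → adj (F G) (inj₁ w) y ≡ true → f y ≡ 0
  light⇒neighbour-zero {w} {y} light wy with f y in fy
  ... | zero  = refl
  ... | suc _ = contradiction (≤-trans 1≤AN AN≤0) λ ()
    where
    1≤AN : 1 ≤ cardAN (F G) f (inj₁ w)
    1≤AN = positive-neighbour⇒1≤cardAN (F G) {f = f} (vs-complete G y) wy (subst (1 ≤_) (sym fy) (s≤s z≤n))
    AN≤0 : cardAN (F G) f (inj₁ w) ≤ 0
    AN≤0 = +-cancelˡ-≤ k _ 0 (≤-trans (IsKRDF⇒dominated (F G) isKRDF (inj₁ w))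
                                      (≤-trans (light⇒closed≤k light) (≤-reflexive (sym (+-identityʳ k)))))

  core-bound : ∀ e → 3 * k + 2 ≤ gadgetCore (f ∘ gadget G e)
  core-bound e = gadget-core-lower f _ _ (gadget G e) k≥2 (IsKRDF⇒gadget-dominated G isKRDF e)

  edge-bound : ∀ e → 3 * k + 2 + 𝟙 (uncovered G heavy e) ≤ gadgetCore (f ∘ gadget G e)
  edge-bound e with heavy (uEnd G e) in hu | heavy (vEnd G e) in hv
  ... | true  | _     = ≤-trans (≤-reflexive (+-identityʳ _)) (core-bound e)
  ... | false | true  = ≤-trans (≤-reflexive (+-identityʳ _)) (core-bound e)
  ... | false | false = ≤-trans (≤-reflexive (+-assoc (3 * k) 2 1))
      (gadget-core-lower-light f _ _ (gadget G e) (≤-trans (s≤s z≤n) k≥2)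
        (≤-trans (m≤m+n _ _) (light⇒closed≤k hu)) (≤-trans (m≤m+n _ _) (light⇒closed≤k hv))
        (light⇒neighbour-zero hu (adj-uEnd-port G e)) (light⇒neighbour-zero hv (adj-vEnd-port G e))
        (IsKRDF⇒gadget-dominated G isKRDF e))

  weight-bound : ∀ {t} → Tau≡ G t → t + k * n G + (3 * k + 2) * m G ≤ weight (F G) f
  weight-bound {t} τ = begin
    t + k * n G + (3 * k + 2) * m G
      ≤⟨ +-monoˡ-≤ _ (+-monoˡ-≤ _ (τ≤size+uncovered τ heavy)) ⟩
    coverSize G heavy + #uncovered + k * n G + (3 * k + 2) * m G
      ≡⟨ cong (λ c → c + #uncovered + k * n G + (3 * k + 2) * m G) (coverSize≡∑ G heavy) ⟩
    #heavy + #uncovered + k * n G + (3 * k + 2) * m G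
      ≡⟨ rearrange #heavy #uncovered k (n G) (m G) ⟩
    (n G * k + #heavy) + (m G * (3 * k + 2) + #uncovered)
      ≡⟨ cong₂ _+_ (∑-const-+ (n G) k (𝟙 ∘ heavy)) (∑-const-+ (m G) (3 * k + 2) (𝟙 ∘ uncovered G heavy)) ⟨
    ∑[ w < n G ] (k + 𝟙 (heavy w)) + ∑[ e < m G ] (3 * k + 2 + 𝟙 (uncovered G heavy e))
      ≤⟨ +-mono-≤ (∑-mono-≤ k+heavy≤closed) (∑-mono-≤ edge-bound) ⟩
    ∑[ w < n G ] closed w + ∑[ e < m G ] gadgetCore (f ∘ gadget G e)
      ≡⟨ weight-F G f ⟨
    weight (F G) f ∎
    where
    open ≤-Reasoning
    #heavy #uncovered : ℕ
    #heavy     = ∑[ w < n G ] 𝟙 (heavy w)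
    #uncovered = ∑[ e < m G ] 𝟙 (uncovered G heavy e)
    rearrange : ∀ a b k n m → a + b + k * n + (3 * k + 2) * m ≡ (n * k + a) + (m * (3 * k + 2) + b)
    rearrange = solve-∀

module UpperBound (k : ℕ) (G : EGraph) (S : Fin (n G) → Bool) (cover : IsVertexCover G S) where

  gadgetLevel : Fin (m G) → Fin 10 → Level
  gadgetLevel e = if S (uEnd G e) then patternU else patternV

  level : VF G → Level
  level (inj₁ w)       = if S w then strong else on
  level (inj₂ (e , j)) = gadgetLevel e j

  gadget-pattern : ∀ e → GadgetPattern (gadgetLevel e) (if S (uEnd G e) then 0F else 4F)
  gadget-pattern e = pattern-for (S (uEnd G e))

  strong-in-cover : ∀ {w} → S w ≡ true → level (inj₁ w) ≡ strong
  strong-in-cover = cong (if_then strong else on)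

  supported : ∀ x → level x ≡ off → ∃[ y ] adj (F G) x y ≡ true × level y ≡ strong
  supported (inj₁ w) ℓ≡off with S w
  ... | true  = contradiction ℓ≡off λ ()
  ... | false = contradiction ℓ≡off λ ()
  supported (inj₂ (e , j)) ℓ≡off with GadgetPattern.supported (gadget-pattern e) j ℓ≡off
  ... | inj₂ (j' , jj' , ℓj') = gadget G e j' , trans (adj-gadget-same G e j j') jj' , ℓj'
  ... | inj₁ j≡port with S (uEnd G e) in Su
  ...   | true  rewrite j≡port =
    inj₁ (uEnd G e) ,
    trans (adj-sym G (gadget G e 0F) (inj₁ (uEnd G e))) (adj-uEnd-port G e) ,
    strong-in-cover Su
  ...   | false rewrite j≡port =
    inj₁ (vEnd G e) ,
    trans (adj-sym G (gadget G e 4F) (inj₁ (vEnd G e))) (adj-vEnd-port G e) ,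
    strong-in-cover (vEnd-in-cover Su)
    where
    vEnd-in-cover : S (uEnd G e) ≡ false → S (vEnd G e) ≡ true
    vEnd-in-cover Su≡false with cover e
    ... | inj₁ Su≡true = contradiction (trans (sym Su≡true) Su≡false) λ ()
    ... | inj₂ Sv≡true = Sv≡true

  independent : ∀ x y → adj (F G) x y ≡ true → level x ≡ off ⊎ level y ≡ off
  independent (inj₁ _) (inj₁ _) ()
  independent (inj₁ w) (inj₂ (e , j)) wj =
    inj₂ (GadgetPattern.ports-off (gadget-pattern e) j (adj-vertex-gadget⇒port G w e j wj))
  independent (inj₂ (e , j)) (inj₁ w) jw =
    inj₁ (GadgetPattern.ports-off (gadget-pattern e) j
           (adj-vertex-gadget⇒port G w e j (trans (adj-sym G (inj₁ w) (gadget G e j)) jw)))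
  independent (inj₂ (e , i)) (inj₂ (e' , j)) = same-gadget (e Fin.≟ e')
    where
    same-gadget : Dec (e ≡ e') → adj (F G) (gadget G e i) (gadget G e' j) ≡ true →
      gadgetLevel e i ≡ off ⊎ gadgetLevel e' j ≡ off
    same-gadget (yes refl) ij =
      GadgetPattern.independent (gadget-pattern e) i j (trans (sym (adj-gadget-same G e i j)) ij)
    same-gadget (no e≢e') ij = contradiction (trans (sym (adj-gadget-≢ G i j e≢e')) ij) λ ()

  weight-level : weight (F G) (value k ∘ level) ≡ coverSize G S + k * n G + (3 * k + 2) * m G
  weight-level = begin
    weight (F G) (value k ∘ level)
      ≡⟨ sum-vs G (value k ∘ level) ⟩
    ∑[ w < n G ] value k (level (inj₁ w)) + ∑[ e < m G ] ∑[ j < 10 ] value k (gadgetLevel e j)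
      ≡⟨ cong₂ _+_ (sum-cong-≗ vertex-value) (sum-cong-≗ λ e → GadgetPattern.value-sum (gadget-pattern e) k) ⟩
    ∑[ w < n G ] (k + 𝟙 (S w)) + ∑[ e < m G ] (3 * k + 2)
      ≡⟨ cong₂ _+_ (∑-const-+ (n G) k (𝟙 ∘ S)) (∑-const (m G) (3 * k + 2)) ⟩
    n G * k + ∑[ w < n G ] 𝟙 (S w) + m G * (3 * k + 2)
      ≡⟨ cong (λ c → n G * k + c + m G * (3 * k + 2)) (coverSize≡∑ G S) ⟨
    n G * k + coverSize G S + m G * (3 * k + 2)
      ≡⟨ rearrange (coverSize G S) k (n G) (m G) ⟩
    coverSize G S + k * n G + (3 * k + 2) * m G ∎
    where
    open ≡-Reasoning
    vertex-value : ∀ w → value k (level (inj₁ w)) ≡ k + 𝟙 (S w)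
    vertex-value w with S w
    ... | true  = +-comm 1 k
    ... | false = sym (+-identityʳ k)
    rearrange : ∀ c k n m → n * k + c + m * (3 * k + 2) ≡ c + k * n + (3 * k + 2) * m
    rearrange = solve-∀

theorem2p6 : (k : ℕ) → 3 ≤ k → (G : EGraph) →
    IsSimple G → TwoConnected G → Planar G → Cubic G →
    (t : ℕ) → Tau≡ G t →
    GammaKR≡ (F G) k (t + k * n G + (3 * k + 2) * m G) ×
    IKR≡ (F G) k (t + k * n G + (3 * k + 2) * m G)
theorem2p6 k k≥3 G _ _ _ _ t τ@((S , cover , |S|≡t) , _) =
  ((optimum , isKRDF , weight≡) , λ _ (f , f-KRDF , wf) → lower f f-KRDF wf) ,
  ((optimum , (isKRDF , isIndependent) , weight≡) , λ _ (f , (f-KRDF , _) , wf) → lower f f-KRDF wf)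
  where
  open UpperBound k G S cover
  optimum : VF G → ℕ
  optimum = value k ∘ level
  isKRDF : IsKRDF (F G) k optimum
  isKRDF = levels-IsKRDF (F G) k level (vs-complete G) supported
  isIndependent : PositiveIndependent (F G) optimum
  isIndependent = levels-PositiveIndependent (F G) k level independent
  weight≡ : weight (F G) optimum ≡ t + k * n G + (3 * k + 2) * m G
  weight≡ = trans weight-level (cong (λ c → c + k * n G + (3 * k + 2) * m G) |S|≡t)
  lower : ∀ {w} f → IsKRDF (F G) k f → weight (F G) f ≡ w → t + k * n G + (3 * k + 2) * m G ≤ w
  lower f f-KRDF refl = LowerBound.weight-bound k (≤-trans (n≤1+n 2) k≥3) G f f-KRDF τ
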